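{- Let $\mathcal{M} = (S, Z, N, U, \rho)$ be a non-empty marked static topology model with $N = U = \emptyset$. Consider the procedure: while there is a sensor $\mathbf{s} \notin U$ that is possibly redundant in the current model, choose (non-deterministically) such an $\mathbf{s}$ and replace $U$ by $U \cup \{\mathbf{s}\}$ (leaving $S, Z, N, \rho$ unchanged); after the loop, replace $N$ by $S \setminus U$ and return the resulting model. For every sequence of choices the procedure terminates and returns an irreducible marked model.
   Context: A marked static topology model is a tuple $(S, Z, N, U, \rho)$ where $S$ is a finite set of sensors, $Z \subseteq \mathcal{P}(S)$ with $\emptyset \notin Z$, every sensor lies in at least one zone, $\rho(\mathbf{s}) = \{z \in Z \mid \mathbf{s} \in z\}$, and $N, U \subseteq S$ are disjoint (sensors marked necessary and unnecessary); it is non-empty if $S\neq\emptyset$. A sensor $\mathbf{s}$ is possibly redundant in $(S,Z,N,U,\rho)$ if for every $z \in \rho(\mathbf{s})$ there is $\mathbf{t} \in S$ with $\mathbf{t} \neq \mathbf{s}$, $\mathbf{t} \notin U$ and $z \in \rho(\mathbf{t})$. A non-empty marked model $(S,Z,N,U,\rho)$ is irreducible if every zone lies in the range of some sensor in $N$, every sensor lies in $N \cup U$, and every possibly redundant sensor lies in $U$. -}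

module Defs where

open import Data.Nat using (ℕ; _<_)
open import Data.Fin using (Fin)
open import Data.Fin.Subset using (Subset; _∈_; _∉_; Nonempty; ⁅_⁆; _∪_; ∁; ⊥)
open import Data.List using (List)
open import Data.List.Relation.Unary.All using (All)
import Data.List.Membership.Propositional as LM
open import Data.Product using (∃; _×_)
open import Data.Sum using (_⊎_)
open import Relation.Binary.PropositionalEquality using (_≡_; _≢_)
open import Relation.Nullary using (¬_)

-- A marked static topology model with sensor set S = Fin n.
-- Zones Z are given as a list of subsets of S (the set Z is the set of
-- list elements; repetitions are harmless for every notion below).
-- ρ(s) = { z ∈ Z | s ∈ z } is expressed by  z LM.∈ Z × s ∈ z.
record MarkedModel : Set where
  constructor model
  field
    n : ℕ
    Z : List (Subset n)
    N : Subset n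
    U : Subset n

InRange : ∀ {n} → List (Subset n) → Fin n → Subset n → Set
InRange Z s z = z LM.∈ Z × s ∈ z

record WellFormed (M : MarkedModel) : Set where
  open MarkedModel M
  field
    noEmptyZone : All Nonempty Z
    covered     : ∀ (s : Fin n) → ∃ λ z → InRange Z s z
    disjointNU  : ∀ (s : Fin n) → s ∈ N → s ∉ U

NonEmptyModel : MarkedModel → Set
NonEmptyModel M = 0 < MarkedModel.n M

PossiblyRedundant : ∀ {n} → List (Subset n) → Subset n → Fin n → Set
PossiblyRedundant {n} Z U s =
  ∀ (z : Subset n) → InRange Z s z →
    ∃ λ (t : Fin n) → t ≢ s × t ∉ U × InRange Z t z

record Irreducible (M : MarkedModel) : Set where
  open MarkedModel M
  field
    wellFormed : WellFormed M
    nonEmpty   : NonEmptyModel M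
    zonesCovN  : ∀ (z : Subset n) → z LM.∈ Z → ∃ λ (s : Fin n) → s ∈ N × InRange Z s z
    allMarked  : ∀ (s : Fin n) → s ∈ N ⊎ s ∈ U
    redundantU : ∀ (s : Fin n) → PossiblyRedundant Z U s → s ∈ U

Step : ∀ {n} → List (Subset n) → Subset n → Subset n → Set
Step {n} Z U U' = ∃ λ (s : Fin n) → s ∉ U × PossiblyRedundant Z U s × U' ≡ ⁅ s ⁆ ∪ U

Stuck : ∀ {n} → List (Subset n) → Subset n → Set
Stuck {n} Z U = ∀ (s : Fin n) → s ∉ U → ¬ PossiblyRedundant Z U s

-- Two facts drive the proof.
--   * Termination: every step strictly enlarges U, and strict supersets of
--     subsets of a finite set are well-founded (Data.Fin.Subset.Induction).
--   * Invariant: every zone contains a sensor outside U.  It holds at U = ∅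
--     because zones are non-empty, and a step preserves it: if the marked
--     sensor s lies in the zone, possible redundancy of s supplies another
--     unmarked sensor of that zone; otherwise the old witness is not s.
-- When the loop exits (no unmarked sensor is possibly redundant) and N is
-- set to S ∖ U, the invariant says every zone is covered by N, every sensor
-- is in N or U by construction, and the exit condition forces every
-- possibly redundant sensor into U: the resulting model is irreducible.
module Submission where

open import Defs
open import Data.Nat using (ℕ)
open import Data.Fin using (Fin)
open import Data.Fin.Subset using (Subset; ⊥; ∁; _∈_; _∉_; ⁅_⁆; _∪_; _⊂_; Nonempty)
open import Data.Fin.Subset.Properties
  using (_∈?_; ∉⊥; x∈⁅x⁆; x≢y⇒x∉⁅y⁆; x∈p∪q⁻; p⊆p∪q; q⊆p∪q; x∉p⇒x∈∁p; x∈∁p⇒x∉p)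
open import Data.Fin.Subset.Induction using (⊃-wellFounded)
open import Data.List using (List)
open import Data.List.Relation.Unary.All using (All; lookup)
import Data.List.Membership.Propositional as LM
open import Data.Product using (_×_; _,_; ∃)
open import Data.Sum using (_⊎_; inj₁; inj₂; [_,_]′)
open import Function using (id; _∘_)
open import Induction.WellFounded using (Acc; module Subrelation)
open import Relation.Binary.Construct.Closure.ReflexiveTransitive using (Star; fold)
open import Relation.Binary.PropositionalEquality using (_≢_; refl)
open import Relation.Nullary using (yes; no)
open import Relation.Nullary.Decidable using (decidable-stable)

∉-⁅⁆∪ : ∀ {n} {s t : Fin n} {U : Subset n} → t ≢ s → t ∉ U → t ∉ ⁅ s ⁆ ∪ U
∉-⁅⁆∪ {s = s} {U = U} t≢s t∉U = [ x≢y⇒x∉⁅y⁆ t≢s , t∉U ]′ ∘ x∈p∪q⁻ ⁅ s ⁆ U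

module _ {n : ℕ} (Z : List (Subset n)) where

  step-⊂ : ∀ {U U'} → Step Z U U' → U ⊂ U'
  step-⊂ {U} (s , s∉U , _ , refl) = q⊆p∪q ⁅ s ⁆ U , s , p⊆p∪q U (x∈⁅x⁆ s) , s∉U

  step-terminates : ∀ U → Acc (λ U' U → Step Z U U') U
  step-terminates = Subrelation.wellFounded step-⊂ ⊃-wellFounded

  ZonesHaveUnmarked : Subset n → Set
  ZonesHaveUnmarked U = ∀ z → z LM.∈ Z → ∃ λ t → t ∉ U × t ∈ z

  zonesHaveUnmarked-⊥ : All Nonempty Z → ZonesHaveUnmarked ⊥
  zonesHaveUnmarked-⊥ nonEmptyZones z z∈Z =
    let (t , t∈z) = lookup nonEmptyZones z∈Z in t , ∉⊥ , t∈z

  step-preserves : ∀ {U U'} → Step Z U U' → ZonesHaveUnmarked U → ZonesHaveUnmarked U'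
  step-preserves (s , _ , s-redundant , refl) inv z z∈Z with s ∈? z
  ... | yes s∈z = let (t , t≢s , t∉U , _ , t∈z) = s-redundant z (z∈Z , s∈z)
                  in t , ∉-⁅⁆∪ t≢s t∉U , t∈z
  ... | no  s∉z = let (t , t∉U , t∈z) = inv z z∈Z
                  in t , ∉-⁅⁆∪ (λ { refl → s∉z t∈z }) t∉U , t∈z

  run-preserves : ∀ {U U'} → Star (Step Z) U U' → ZonesHaveUnmarked U → ZonesHaveUnmarked U'
  run-preserves = fold (λ U U' → ZonesHaveUnmarked U → ZonesHaveUnmarked U')
                       (λ step rest → rest ∘ step-preserves step) id

  exit-irreducible : ∀ {N₀ U₀} U → NonEmptyModel (model n Z N₀ U₀) →
    WellFormed (model n Z N₀ U₀) → ZonesHaveUnmarked U → Stuck Z U →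
    Irreducible (model n Z (∁ U) U)
  exit-irreducible U nonEmpty wf inv stuck = record
    { wellFormed = record
        { noEmptyZone = noEmptyZone
        ; covered     = covered
        ; disjointNU  = λ _ → x∈∁p⇒x∉p }
    ; nonEmpty   = nonEmpty
    ; zonesCovN  = λ z z∈Z → let (t , t∉U , t∈z) = inv z z∈Z
                             in t , x∉p⇒x∈∁p t∉U , z∈Z , t∈z
    ; allMarked  = marked
    ; redundantU = λ s s-redundant →
        decidable-stable (s ∈? U) (λ s∉U → stuck s s∉U s-redundant) }
    where
    open WellFormed wf
    marked : ∀ s → s ∈ ∁ U ⊎ s ∈ U
    marked s with s ∈? U
    ... | yes s∈U = inj₂ s∈U
    ... | no  s∉U = inj₁ (x∉p⇒x∈∁p s∉U)

mainTheorem8 : (n : ℕ) (Z : List (Subset n)) →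
    NonEmptyModel (model n Z ⊥ ⊥) → WellFormed (model n Z ⊥ ⊥) →
    Acc (λ U' U → Step Z U U') ⊥
    × (∀ (U : Subset n) → Star (Step Z) ⊥ U → Stuck Z U →
    Irreducible (model n Z (∁ U) U))
mainTheorem8 n Z nonEmpty wf = step-terminates Z ⊥ , λ U run stuck →
  exit-irreducible Z U nonEmpty wf
    (run-preserves Z run (zonesHaveUnmarked-⊥ Z (WellFormed.noEmptyZone wf))) stuck
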